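{- Let $r\geq3$, let $D$ be an $m$-colored semicomplete $r$-partite digraph such that every directed $3$-cycle and every directed $4$-cycle contained in $D$ is monochromatic, and let $x,y\in V(D)$. If there exists a $2$-colored directed path from $x$ to $y$ and there does not exist a $k'$-colored directed path from $y$ to $x$ with $k'\leq 2$, then $d(x,y)\leq 2$.
   Context: A digraph is $m$-colored if each arc is assigned one of $m$ colors. A semicomplete $r$-partite digraph is obtained from a complete $r$-partite graph by replacing each edge $uv$ by the arc $(u,v)$, the arc $(v,u)$, or both; no arcs join vertices of the same part. A directed path is $j$-colored if its arcs use exactly $j$ distinct colors; a subdigraph is monochromatic if all its arcs have the same color. $d(x,y)$ denotes the minimum number of arcs of a directed path from $x$ to $y$. -}

module Defs where

open import Data.Nat using (ℕ; zero; suc; _≤_)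
open import Data.Fin using (Fin; _≟_)
open import Data.List using (List; []; _∷_; length; deduplicate)
open import Data.List.Relation.Unary.Unique.Propositional using (Unique)
open import Data.Product using (Σ; ∃; _×_; _,_)
open import Data.Sum using (_⊎_)
open import Relation.Binary.PropositionalEquality using (_≡_; _≢_)

-- A digraph on vertex set Fin n: an arc relation `Arc`.
-- An m-colouring assigns a colour `col u v : Fin m` to every ordered pair;
-- only its values on arcs are ever used.

record SemicompleteMultipartite {n r : ℕ} (part : Fin n → Fin r)
       (Arc : Fin n → Fin n → Set) : Set where
  field
    partsNonempty : ∀ (i : Fin r) → ∃ λ v → part v ≡ i
    noArcInPart   : ∀ u v → Arc u v → part u ≢ part v
    semicomplete  : ∀ u v → part u ≢ part v → Arc u v ⊎ Arc v u

module _ {n m : ℕ} (Arc : Fin n → Fin n → Set) (col : Fin n → Fin n → Fin m) where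

  data Walk : Fin n → Fin n → Set where
    nil  : ∀ {x} → Walk x x
    cons : ∀ {x y z} → Arc x y → Walk y z → Walk x z

  verts : ∀ {x y} → Walk x y → List (Fin n)
  verts {x} nil        = x ∷ []
  verts {x} (cons _ w) = x ∷ verts w

  arcColours : ∀ {x y} → Walk x y → List (Fin m)
  arcColours nil                  = []
  arcColours (cons {x} {y} _ w)   = col x y ∷ arcColours w

  len : ∀ {x y} → Walk x y → ℕ
  len nil        = zero
  len (cons _ w) = suc (len w)

  IsPath : ∀ {x y} → Walk x y → Set
  IsPath w = Unique (verts w)

  numColours : ∀ {x y} → Walk x y → ℕ
  numColours w = length (deduplicate _≟_ (arcColours w))

  ColouredPath : ℕ → Fin n → Fin n → Set
  ColouredPath j x y = Σ (Walk x y) λ w → IsPath w × numColours w ≡ j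

  DistLe : Fin n → Fin n → ℕ → Set
  DistLe x y k = Σ (Walk x y) λ w → IsPath w × len w ≤ k

  All3CyclesMono : Set
  All3CyclesMono = ∀ a b c → a ≢ b → b ≢ c → a ≢ c →
    Arc a b → Arc b c → Arc c a →
    col a b ≡ col b c × col b c ≡ col c a

  All4CyclesMono : Set
  All4CyclesMono = ∀ a b c d → a ≢ b → a ≢ c → a ≢ d → b ≢ c → b ≢ d → c ≢ d →
    Arc a b → Arc b c → Arc c d → Arc d a →
    col a b ≡ col b c × col b c ≡ col c d × col c d ≡ col d a

module Submission where

-- Let X be the part containing x and suppose no ≤2-coloured path runs from y
-- back to x.  If y ∉ X, the arc between x and y must point from x to y, since
-- the reverse arc would be a 1-coloured return path.  If y ∈ X, every vertex z
-- outside X is adjacent to both x and y; x → z → y gives d(x,y) ≤ 2, while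
-- y → z → x is a forbidden 2-arc return path, so otherwise z is of type "in"
-- (z → x, z → y) or "out" (x → z, y → z).  Following any walk from x to y, the
-- second vertex is an "out" vertex (or gives x → z → y), and an "out" vertex
-- can never be followed, directly or through one vertex of X, by an "in"
-- vertex: the monochromatic 3- and 4-cycles through x and through y would make
-- y → u → (w →) t → x a monochromatic, hence 1-coloured, return path.  So the
-- walk stays among "out" vertices and X until it enters y, which happens from
-- an "out" vertex u and yields x → u → y.

open import Defs
open import Data.Nat using (ℕ; _≤_; z≤n; s≤s)
open import Data.Nat.Properties using (≤-trans; n≤1+n)
open import Data.Fin using (Fin; _≟_)
open import Data.Product using (Σ; _×_; _,_; proj₁; proj₂)
open import Data.Sum using (_⊎_; inj₁; inj₂)
open import Data.Empty using (⊥; ⊥-elim)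
open import Data.List using (List; []; _∷_; length; deduplicate)
open import Data.List.Properties using (length-deduplicate; filter-none)
open import Data.List.Relation.Unary.All as All using (All; []; _∷_)
open import Data.List.Relation.Unary.All.Properties using (deduplicate⁺)
open import Data.List.Relation.Unary.AllPairs using ([]; _∷_)
open import Function using (_∘_)
open import Relation.Nullary using (¬_; yes; no; ¬?)
open import Relation.Binary.PropositionalEquality using (_≡_; _≢_; refl; sym; trans; cong)

deduplicate-constant : ∀ {m} (c : Fin m) (cs : List (Fin m)) → All (_≡ c) cs →
  length (deduplicate _≟_ cs) ≤ 1
deduplicate-constant c []        []         = z≤n
deduplicate-constant c (c ∷ cs) (refl ∷ eq)
  rewrite filter-none (¬? ∘ (c ≟_)) {deduplicate _≟_ cs}
            (All.map (λ e e′ → e′ (sym e)) (deduplicate⁺ _≟_ eq)) = s≤s z≤n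

module _ {n m : ℕ} {Arc : Fin n → Fin n → Set} {col : Fin n → Fin n → Fin m} where

  numColours≤len : ∀ {a b} (w : Walk Arc col a b) → numColours Arc col w ≤ len Arc col w
  numColours≤len w = ≤-trans (length-deduplicate _≟_ (arcColours Arc col w)) (length-arcColours w)
    where
    length-arcColours : ∀ {a b} (w : Walk Arc col a b) →
      length (arcColours Arc col w) ≤ len Arc col w
    length-arcColours nil        = z≤n
    length-arcColours (cons _ w) = s≤s (length-arcColours w)

  monochromatic⇒numColours≤1 : ∀ {a b} (c : Fin m) (w : Walk Arc col a b) →
    All (_≡ c) (arcColours Arc col w) → numColours Arc col w ≤ 1
  monochromatic⇒numColours≤1 c w = deduplicate-constant c (arcColours Arc col w)

  Path : Fin n → Fin n → Set
  Path a b = Σ (Walk Arc col a b) (IsPath Arc col)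

  path₁ : ∀ {a b} → a ≢ b → Arc a b → Path a b
  path₁ a≢b ab = cons ab nil , (a≢b ∷ []) ∷ [] ∷ []

  path₂ : ∀ {a b c} → a ≢ b → a ≢ c → b ≢ c → Arc a b → Arc b c → Path a c
  path₂ a≢b a≢c b≢c ab bc =
    cons ab (cons bc nil) , (a≢b ∷ a≢c ∷ []) ∷ (b≢c ∷ []) ∷ [] ∷ []

  path₃ : ∀ {a b c d} → a ≢ b → a ≢ c → a ≢ d → b ≢ c → b ≢ d → c ≢ d →
    Arc a b → Arc b c → Arc c d → Path a d
  path₃ a≢b a≢c a≢d b≢c b≢d c≢d ab bc cd =
    cons ab (cons bc (cons cd nil))
    , (a≢b ∷ a≢c ∷ a≢d ∷ []) ∷ (b≢c ∷ b≢d ∷ []) ∷ (c≢d ∷ []) ∷ [] ∷ []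

  path₄ : ∀ {a b c d e} → a ≢ b → a ≢ c → a ≢ d → a ≢ e → b ≢ c → b ≢ d → b ≢ e →
    c ≢ d → c ≢ e → d ≢ e → Arc a b → Arc b c → Arc c d → Arc d e → Path a e
  path₄ a≢b a≢c a≢d a≢e b≢c b≢d b≢e c≢d c≢e d≢e ab bc cd de =
    cons ab (cons bc (cons cd (cons de nil)))
    , (a≢b ∷ a≢c ∷ a≢d ∷ a≢e ∷ []) ∷ (b≢c ∷ b≢d ∷ b≢e ∷ []) ∷ (c≢d ∷ c≢e ∷ [])
      ∷ (d≢e ∷ []) ∷ [] ∷ []

module SamePart {n m r : ℕ} {part : Fin n → Fin r} {Arc : Fin n → Fin n → Set}
  {col : Fin n → Fin n → Fin m}
  (S : SemicompleteMultipartite part Arc)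
  (mono₃ : All3CyclesMono Arc col) (mono₄ : All4CyclesMono Arc col)
  (x y : Fin n)
  (noReturn : ¬ (Σ ℕ λ k′ → k′ ≤ 2 × ColouredPath Arc col k′ y x))
  (sameXY : part x ≡ part y) where

  open SemicompleteMultipartite S

  X : Fin r
  X = part x

  Outside : Fin n → Set
  Outside z = part z ≢ X

  Goal : Set
  Goal = DistLe Arc col x y 2

  Out In : Fin n → Set
  Out z = Arc x z × Arc y z
  In  z = Arc z x × Arc z y

  inside≢outside : ∀ {a z} → part a ≡ X → Outside z → a ≢ z
  inside≢outside pa pz refl = pz pa

  outside≢inside : ∀ {a z} → part a ≡ X → Outside z → z ≢ a
  outside≢inside pa pz refl = pz pa

  partY : part y ≡ X
  partY = sym sameXY

  noShortReturn : (p : Path y x) → numColours Arc col (proj₁ p) ≤ 2 → ⊥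
  noShortReturn (w , isPath) k≤2 = noReturn (_ , k≤2 , w , isPath , refl)

  noMonoReturn : (c : Fin m) (p : Path y x) → All (_≡ c) (arcColours Arc col (proj₁ p)) → ⊥
  noMonoReturn c (w , isPath) mono =
    noShortReturn (w , isPath) (≤-trans (monochromatic⇒numColours≤1 c w mono) (n≤1+n 1))

  -- x ≠ y, since the trivial path y = x uses no colour.
  x≢y : x ≢ y
  x≢y refl = noShortReturn (nil , [] ∷ []) z≤n

  noTwoArcReturn : ∀ {z} → Arc y z → Arc z x → Outside z → ⊥
  noTwoArcReturn yz zx pz =
    noShortReturn p (numColours≤len (proj₁ p))
    where
    p : Path y x
    p = path₂ (inside≢outside partY pz) (x≢y ∘ sym) (outside≢inside refl pz) yz zx

  twoArcGoal : ∀ {z} → Arc x z → Arc z y → Outside z → Goal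
  twoArcGoal xz zy pz =
    proj₁ p , proj₂ p , s≤s (s≤s z≤n)
    where
    p : Path x y
    p = path₂ (inside≢outside refl pz) x≢y (outside≢inside partY pz) xz zy

  classify : ∀ z → Outside z → Goal ⊎ (In z ⊎ Out z)
  classify z pz with semicomplete z x pz | semicomplete z y (λ e → pz (trans e partY))
  ... | inj₁ zx | inj₁ zy = inj₂ (inj₁ (zx , zy))
  ... | inj₁ zx | inj₂ yz = ⊥-elim (noTwoArcReturn yz zx pz)
  ... | inj₂ xz | inj₁ zy = inj₁ (twoArcGoal xz zy pz)
  ... | inj₂ xz | inj₂ yz = inj₂ (inj₂ (xz , yz))

  out≢in : ∀ {u t} → Out u → In t → Outside u → u ≢ t
  out≢in (_ , yu) (tx , _) pu refl = noTwoArcReturn yu tx pu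

  -- No arc from an Out vertex u to an In vertex t: the 3-cycles x u t and
  -- y u t make y → u → t → x monochromatic.
  noOutInArc : ∀ {u t} → Out u → In t → Arc u t → Outside u → Outside t → ⊥
  noOutInArc {u} {t} (xu , yu) (tx , ty) ut pu pt =
    noMonoReturn (col y u) p (refl ∷ sym yu≡ut ∷ trans (sym ut≡tx) (sym yu≡ut) ∷ [])
    where
    u≢t : u ≢ t
    u≢t = out≢in (xu , yu) (tx , ty) pu
    yu≡ut : col y u ≡ col u t
    yu≡ut = proj₁ (mono₃ y u t (inside≢outside partY pu) u≢t (inside≢outside partY pt) yu ut ty)
    ut≡tx : col u t ≡ col t x
    ut≡tx = proj₂ (mono₃ x u t (inside≢outside refl pu) u≢t (inside≢outside refl pt) xu ut tx)
    p : Path y x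
    p = path₃ (inside≢outside partY pu) (inside≢outside partY pt) (x≢y ∘ sym)
              u≢t (outside≢inside refl pu) (outside≢inside refl pt) yu ut tx

  -- No path u → w → t from an Out vertex through X to an In vertex: the
  -- 4-cycles x u w t and y u w t make y → u → w → t → x monochromatic.
  noOutInDetour : ∀ {u w t} → Out u → Arc u w → part w ≡ X → Arc w t → In t →
    Outside u → Outside t → ⊥
  noOutInDetour {u} {w} {t} (xu , yu) uw pw wt (tx , ty) pu pt =
    noMonoReturn (col y u) p (refl ∷ sym yu≡uw ∷ trans (sym uw≡wt) (sym yu≡uw)
                              ∷ trans (sym wt≡tx) (trans (sym uw≡wt) (sym yu≡uw)) ∷ [])
    where
    u≢t : u ≢ t
    u≢t = out≢in (xu , yu) (tx , ty) pu
    w≢x : w ≢ x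
    w≢x refl = noTwoArcReturn yu uw pu
    w≢y : w ≢ y
    w≢y refl = noTwoArcReturn wt tx pt
    u≢w : u ≢ w
    u≢w = outside≢inside pw pu
    w≢t : w ≢ t
    w≢t = inside≢outside pw pt
    yu≡uw : col y u ≡ col u w
    yu≡uw = proj₁ (mono₄ y u w t (inside≢outside partY pu) (w≢y ∘ sym) (inside≢outside partY pt)
                         u≢w u≢t w≢t yu uw wt ty)
    cycleX : col x u ≡ col u w × col u w ≡ col w t × col w t ≡ col t x
    cycleX = mono₄ x u w t (inside≢outside refl pu) (w≢x ∘ sym) (inside≢outside refl pt)
                   u≢w u≢t w≢t xu uw wt tx
    uw≡wt : col u w ≡ col w t
    uw≡wt = proj₁ (proj₂ cycleX)
    wt≡tx : col w t ≡ col t x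
    wt≡tx = proj₂ (proj₂ cycleX)
    p : Path y x
    p = path₄ (inside≢outside partY pu) (w≢y ∘ sym) (inside≢outside partY pt) (x≢y ∘ sym)
              u≢w u≢t (outside≢inside refl pu) w≢t w≢x (outside≢inside refl pt)
              yu uw wt tx

  leavesX : ∀ {b c} → part b ≡ X → Arc b c → Outside c
  leavesX pb bc e = noArcInPart _ _ bc (trans pb (sym e))

  fromOut : ∀ {a} → Out a → Outside a → Walk Arc col a y → Goal
  fromOut out pa nil = ⊥-elim (pa partY)
  fromOut out pa (cons {y = b} ab w) with part b ≟ X
  ... | no pb with classify b pb
  ...   | inj₁ goal        = goal
  ...   | inj₂ (inj₁ inB)  = ⊥-elim (noOutInArc out inB ab pa pb)
  ...   | inj₂ (inj₂ outB) = fromOut outB pb w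
  fromOut out pa (cons ab nil) | yes pb = twoArcGoal (proj₁ out) ab pa
  fromOut out pa (cons ab (cons {y = c} bc w)) | yes pb with classify c (leavesX pb bc)
  ... | inj₁ goal        = goal
  ... | inj₂ (inj₁ inC)  = ⊥-elim (noOutInDetour out ab pb bc inC pa (leavesX pb bc))
  ... | inj₂ (inj₂ outC) = fromOut outC (leavesX pb bc) w

  fromX : Walk Arc col x y → Goal
  fromX nil = ⊥-elim (x≢y refl)
  fromX (cons {y = b} xb w) with semicomplete b y (λ e → leavesX refl xb (trans e partY))
  ... | inj₁ by = twoArcGoal xb by (leavesX refl xb)
  ... | inj₂ yb = fromOut (xb , yb) (leavesX refl xb) w

differentParts : ∀ {n m r} {part : Fin n → Fin r} {Arc : Fin n → Fin n → Set}
  {col : Fin n → Fin n → Fin m} → SemicompleteMultipartite part Arc → (x y : Fin n) →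
  ¬ (Σ ℕ λ k′ → k′ ≤ 2 × ColouredPath Arc col k′ y x) →
  part x ≢ part y → DistLe Arc col x y 2
differentParts {part = part} {Arc} {col} S x y noReturn px≢py
  with SemicompleteMultipartite.semicomplete S x y px≢py
... | inj₁ xy = proj₁ p , proj₂ p , s≤s z≤n
  where
  p : Path {Arc = Arc} {col} x y
  p = path₁ (px≢py ∘ cong part) xy
... | inj₂ yx = ⊥-elim (noReturn (1 , s≤s z≤n , proj₁ p , proj₂ p , refl))
  where
  p : Path {Arc = Arc} {col} y x
  p = path₁ (px≢py ∘ sym ∘ cong part) yx

mainTheorem8 : (n m r : ℕ) → 3 ≤ r →
    (part : Fin n → Fin r) (Arc : Fin n → Fin n → Set) (col : Fin n → Fin n → Fin m) →
    SemicompleteMultipartite part Arc →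
    All3CyclesMono Arc col →
    All4CyclesMono Arc col →
    (x y : Fin n) →
    ColouredPath Arc col 2 x y →
    ¬ (Σ ℕ λ k′ → k′ ≤ 2 × ColouredPath Arc col k′ y x) →
    DistLe Arc col x y 2
mainTheorem8 n m r _ part Arc col S mono₃ mono₄ x y (w , _) noReturn with part x ≟ part y
... | yes same = SamePart.fromX S mono₃ mono₄ x y noReturn same w
... | no  diff = differentParts S x y noReturn diff
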